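{- For every integer $n\ge 1$, $$|B_{x,y}(n,2)|=\frac{15}{8}\,2^n+2^{n-1}n+2^{n-4}n(n+1)-1.$$
   Context: Let $I$ (left vertices) and $O$ (right vertices) be disjoint finite sets with $|I|=n$ and $|O|=r$. An $(n,r)$-bipartite graph is $G=(I\oplus O,E)$ with edge set $E\subseteq I\times O$. The connected domain $I_c(G)$ is the set of vertices of $I$ with nonzero degree in $G$, and the connected co-domain $O_c(G)$ is the set of vertices of $O$ with nonzero degree. Two $(n,r)$-bipartite graphs $G_1=(I\oplus O,E_1)$ and $G_2=(I\oplus O,E_2)$ are set-labeled equivalent if there exist bijections $\alpha:I\to I$ and $\beta:O\to O$ such that for all $x\in I,y\in O$, $(x,y)\in E_1$ iff $(\alpha(x),\beta(y))\in E_2$, and moreover $I_c(G_1)=I_c(G_2)$ and $O_c(G_1)=O_c(G_2)$. $B_{x,y}(n,r)$ denotes the set of equivalence classes of $(n,r)$-bipartite graphs under set-labeled equivalence. -}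

module Defs where

open import Data.Nat using (ℕ)
open import Data.Fin using (Fin)
open import Data.Fin.Permutation using (Permutation′; _⟨$⟩ʳ_)
open import Data.Bool using (Bool; true)
open import Data.Product using (Σ; Σ-syntax; ∃; ∃-syntax; _×_)
open import Function.Bundles using (_⇔_)
open import Relation.Binary.PropositionalEquality using (_≡_)

-- An (n,r)-bipartite graph: left vertices I = Fin n, right vertices O = Fin r,
-- edge set E ⊆ I × O given by its characteristic function.
BipGraph : ℕ → ℕ → Set
BipGraph n r = Fin n → Fin r → Bool

InIc : ∀ {n r} → BipGraph n r → Fin n → Set
InIc {r = r} G x = Σ[ y ∈ Fin r ] G x y ≡ true

InOc : ∀ {n r} → BipGraph n r → Fin r → Set
InOc {n = n} G y = Σ[ x ∈ Fin n ] G x y ≡ true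

SetLabeledEquiv : ∀ {n r} → BipGraph n r → BipGraph n r → Set
SetLabeledEquiv {n} {r} G₁ G₂ =
  Σ[ α ∈ Permutation′ n ] Σ[ β ∈ Permutation′ r ]
    ((∀ (x : Fin n) (y : Fin r) → G₁ x y ≡ true ⇔ G₂ (α ⟨$⟩ʳ x) (β ⟨$⟩ʳ y) ≡ true)
    × (∀ (x : Fin n) → InIc G₁ x ⇔ InIc G₂ x)
    × (∀ (y : Fin r) → InOc G₁ y ⇔ InOc G₂ y))

-- |B_{x,y}(n,r)| = N : there is a surjection from graphs onto Fin N whose
-- fibres are exactly the set-labeled equivalence classes.
NumClasses : ℕ → ℕ → ℕ → Set
NumClasses n r N =
  Σ[ f ∈ (BipGraph n r → Fin N) ]
    ((∀ (k : Fin N) → ∃[ G ] f G ≡ k)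
    × (∀ (G₁ G₂ : BipGraph n r) → (f G₁ ≡ f G₂) ⇔ SetLabeledEquiv G₁ G₂))

-- An (n,2)-bipartite graph is a list of n rows in {00, 11, 10, 01}. A set-labeled
-- equivalence permutes the rows and possibly swaps the two right vertices, while
-- fixing I_c (the nonzero rows) and O_c. Hence the class of a graph is determined by
-- I_c together with its profile (c , p , q), the numbers of rows 11, 10 and 01, where
-- (c , p , q) and (c , q , p) are identified unless the swap moves O_c, i.e. unless
-- c = 0 and exactly one of p, q vanishes. Up to the swap, profiles of size k number
-- b_k = Σ_{s ≤ k} (⌊s/2⌋ + 1), with 2 (b_j + b_{j+1}) = (j + 2)(j + 3); the one-sided
-- profiles add one class for each k > 0, giving a_k classes of profiles of size k.
-- Choosing I_c gives Σ_k C(n,k) a_k classes, and Pascal's rule carries the closed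
-- form from n = 1 to all n.

module Submission where

open import Defs
open import Data.Bool using (Bool; true; false; _∨_; if_then_else_)
open import Data.Bool.Properties using (∨-zeroʳ) renaming (_≟_ to _≟ᵇ_)
open import Data.Empty using (⊥-elim)
open import Data.Fin using (Fin; zero; suc; punchIn; _↑ˡ_; _↑ʳ_; splitAt)
open import Data.Fin.Permutation as Perm using (Permutation′; _⟨$⟩ʳ_; _⟨$⟩ˡ_; inverseˡ; inverseʳ)
open import Data.Fin.Properties using (splitAt⁻¹-↑ˡ; splitAt⁻¹-↑ʳ)
open import Data.Nat using (ℕ; zero; suc; pred; _+_; _*_; _^_; _<_; _≤_; _≥_; z≤n; s≤s; ⌊_/2⌋; ⌈_/2⌉)
open import Data.Nat.Properties
open import Data.Nat.Tactic.RingSolver using (solve-∀)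
open import Data.Product using (Σ-syntax; ∃-syntax; _×_; _,_; proj₁; proj₂; swap; map; map₁; map₂)
open import Data.Product.Properties using (≡-dec)
open import Data.Sum as Sum using (_⊎_; inj₁; inj₂)
open import Data.Vec.Functional using (_++_; _∷_)
open import Data.Vec.Functional.Properties using (lookup-++ˡ; lookup-++ʳ)
open import Function using (_∘_; id; case_of_; _⇔_; mk⇔; Equivalence)
import Function.Properties.Equivalence as ⇔
import Data.Product.Function.Dependent.Propositional as Σ
open import Function.Related.Propositional using (equivalence)
open import Relation.Binary.Definitions using (DecidableEquality)
open import Relation.Binary.PropositionalEquality
open import Relation.Nullary using (yes; no; ¬_)
import Algebra.Properties.CommutativeMonoid.Sum as MonoidSum

-- Counting the values of a function on Fin n

module Counting {a} {A : Set a} (_≟_ : DecidableEquality A) where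
  open MonoidSum +-0-commutativeMonoid using (sum; sum-remove; sum-permute; sum-cong-≗)

  indicator : A → A → ℕ
  indicator a b with a ≟ b
  ... | yes _ = 1
  ... | no  _ = 0

  count : ∀ {n} → (Fin n → A) → A → ℕ
  count g b = sum (λ x → indicator (g x) b)

  indicator-refl : ∀ a → indicator a a ≡ 1
  indicator-refl a with a ≟ a
  ... | yes _  = refl
  ... | no a≢a = ⊥-elim (a≢a refl)

  indicator-cong : ∀ {a b c d} → (a ≡ b ⇔ c ≡ d) → indicator a b ≡ indicator c d
  indicator-cong {a} {b} {c} {d} a≡b⇔c≡d with a ≟ b | c ≟ d
  ... | yes _   | yes _   = refl
  ... | no  _   | no  _   = refl
  ... | yes a≡b | no  c≢d = ⊥-elim (c≢d (Equivalence.to a≡b⇔c≡d a≡b))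
  ... | no  a≢b | yes c≡d = ⊥-elim (a≢b (Equivalence.from a≡b⇔c≡d c≡d))

  count-cong : ∀ {n} {g h : Fin n → A} → (∀ x → g x ≡ h x) → ∀ b → count g b ≡ count h b
  count-cong g≗h b = sum-cong-≗ (λ x → cong (λ c → indicator c b) (g≗h x))

  count-permute : ∀ {n} (g : Fin n → A) (α : Permutation′ n) b → count g b ≡ count (g ∘ (α ⟨$⟩ʳ_)) b
  count-permute g α b = sum-permute (λ x → indicator (g x) b) α

  count-remove : ∀ {n} (g : Fin (suc n) → A) y b → count g b ≡ indicator (g y) b + count (g ∘ punchIn y) b
  count-remove g y b = sum-remove {i = y} (λ x → indicator (g x) b)

  count-involution : ∀ {n} (f : A → A) → (∀ a → f (f a) ≡ a) → (g : Fin n → A) →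
    ∀ b → count (f ∘ g) b ≡ count g (f b)
  count-involution f ff≗id g b = sum-cong-≗ λ x → indicator-cong
    (mk⇔ (λ e → trans (sym (ff≗id (g x))) (cong f e)) (λ e → trans (cong f e) (ff≗id b)))

  count-pos⇒∃ : ∀ {n} (g : Fin n → A) b → 0 < count g b → ∃[ x ] g x ≡ b
  count-pos⇒∃ {suc n} g b pos with g zero ≟ b
  ... | yes g₀≡b = zero , g₀≡b
  ... | no  _    = map suc id (count-pos⇒∃ (g ∘ suc) b pos)

  ∃⇒count-pos : ∀ {n} (g : Fin n → A) {b} x → g x ≡ b → 0 < count g b
  ∃⇒count-pos {suc n} g x refl rewrite count-remove g x (g x) | indicator-refl (g x) = s≤s z≤n

  count-pos-+⇔ : ∀ {n} (g : Fin n → A) b c → 0 < count g b + count g c ⇔ (∃[ x ] (g x ≡ b ⊎ g x ≡ c))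
  count-pos-+⇔ g b c = mk⇔ to from
    where
    to : 0 < count g b + count g c → ∃[ x ] (g x ≡ b ⊎ g x ≡ c)
    to pos with count g b in eq
    ... | zero  = map₂ inj₂ (count-pos⇒∃ g c pos)
    ... | suc _ = map₂ inj₁ (count-pos⇒∃ g b (subst (0 <_) (sym eq) (s≤s z≤n)))
    from : ∃[ x ] (g x ≡ b ⊎ g x ≡ c) → 0 < count g b + count g c
    from (x , inj₁ e) = ≤-trans (∃⇒count-pos g x e) (m≤m+n _ _)
    from (x , inj₂ e) = ≤-trans (∃⇒count-pos g x e) (m≤n+m _ _)

  count-remove-matched : ∀ {n} (g h : Fin (suc n) → A) y → h y ≡ g zero →
    (∀ b → count g b ≡ count h b) → ∀ b → count (g ∘ suc) b ≡ count (h ∘ punchIn y) b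
  count-remove-matched g h y hy≡g₀ counts b = +-cancelˡ-≡ (indicator (g zero) b) _ _ (begin
    indicator (g zero) b + count (g ∘ suc) b       ≡⟨ counts b ⟩
    count h b                                      ≡⟨ count-remove h y b ⟩
    indicator (h y) b + count (h ∘ punchIn y) b    ≡⟨ cong (λ c → indicator c b + _) hy≡g₀ ⟩
    indicator (g zero) b + count (h ∘ punchIn y) b ∎)
    where open ≡-Reasoning

  count⇒permutation : ∀ {n} (g h : Fin n → A) → (∀ b → count g b ≡ count h b) →
    Σ[ α ∈ Permutation′ n ] (∀ x → g x ≡ h (α ⟨$⟩ʳ x))
  count⇒permutation {zero} g h _ = Perm.id , λ ()
  count⇒permutation {suc n} g h counts
    with y , hy≡g₀ ← count-pos⇒∃ h (g zero) (subst (0 <_) (counts (g zero)) (∃⇒count-pos g zero refl))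
    with α , g≗hα ← count⇒permutation (g ∘ suc) (h ∘ punchIn y) (count-remove-matched g h y hy≡g₀ counts)
    = Perm.insert zero y α , λ { zero → sym hy≡g₀ ; (suc x) → g≗hα x }

-- Irredundant lists of representatives

UpTo : ∀ {A : Set} → (A → A) → A → A → Set
UpTo f x y = x ≡ y ⊎ x ≡ f y

module _ {A : Set} where

  ++-all : ∀ (P : A → Set) {m n} {xs : Fin m → A} {ys : Fin n → A} →
    (∀ i → P (xs i)) → (∀ j → P (ys j)) → ∀ k → P ((xs ++ ys) k)
  ++-all P {m} Pxs Pys k with splitAt m k
  ... | inj₁ i = Pxs i
  ... | inj₂ j = Pys j

  module _ (_≈_ : A → A → Set) where

    Irredundant : ∀ {n} → (Fin n → A) → Set
    Irredundant xs = ∀ i j → xs i ≈ xs j → i ≡ j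

    Covers : ∀ {n} → (Fin n → A) → A → Set
    Covers xs a = ∃[ i ] a ≈ xs i

    ++-irredundant : ∀ {m n} {xs : Fin m → A} {ys : Fin n → A} →
      Irredundant xs → Irredundant ys →
      (∀ i j → ¬ xs i ≈ ys j) → (∀ i j → ¬ ys j ≈ xs i) → Irredundant (xs ++ ys)
    ++-irredundant {m} {n} irrˣ irrʸ xs≉ys ys≉xs i j r
      with splitAt m i in eqᵢ | splitAt m j in eqⱼ
    ... | inj₁ k | inj₁ l =
      trans (sym (splitAt⁻¹-↑ˡ eqᵢ)) (trans (cong (_↑ˡ n) (irrˣ k l r)) (splitAt⁻¹-↑ˡ eqⱼ))
    ... | inj₁ k | inj₂ l = ⊥-elim (xs≉ys k l r)
    ... | inj₂ k | inj₁ l = ⊥-elim (ys≉xs l k r)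
    ... | inj₂ k | inj₂ l =
      trans (sym (splitAt⁻¹-↑ʳ eqᵢ)) (trans (cong (m ↑ʳ_) (irrʸ k l r)) (splitAt⁻¹-↑ʳ eqⱼ))

    ++-coversˡ : ∀ {m n} (xs : Fin m → A) (ys : Fin n → A) {a} → Covers xs a → Covers (xs ++ ys) a
    ++-coversˡ xs ys (i , r) = i ↑ˡ _ , subst (_ ≈_) (sym (lookup-++ˡ xs ys i)) r

    ++-coversʳ : ∀ {m n} (xs : Fin m → A) (ys : Fin n → A) {a} → Covers ys a → Covers (xs ++ ys) a
    ++-coversʳ xs ys (j , r) = _ ↑ʳ j , subst (_ ≈_) (sym (lookup-++ʳ xs ys j)) r

-- Classes of profiles and supports

-- Unordered pairs {p, q} with p + q = s, each listed once as (p , q) with p ≤ q.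
splittings : ∀ s → Fin (suc ⌊ s /2⌋) → ℕ × ℕ
splittings s             zero    = 0 , s
splittings (suc (suc s)) (suc i) = map suc suc (splittings s i)

splittings-sum : ∀ s i → proj₁ (splittings s i) + proj₂ (splittings s i) ≡ s
splittings-sum s             zero    = refl
splittings-sum (suc (suc s)) (suc i) =
  cong suc (trans (+-suc _ _) (cong suc (splittings-sum s i)))

splittings-ordered : ∀ s i → proj₁ (splittings s i) ≤ proj₂ (splittings s i)
splittings-ordered s             zero    = z≤n
splittings-ordered (suc (suc s)) (suc i) = s≤s (splittings-ordered s i)

splittings-irredundant : ∀ s → Irredundant (UpTo swap) (splittings s)
splittings-irredundant s             zero    zero    _ = refl
splittings-irredundant (suc (suc s)) zero    (suc j) (inj₁ ())
splittings-irredundant (suc (suc s)) zero    (suc j) (inj₂ ())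
splittings-irredundant (suc (suc s)) (suc i) zero    (inj₁ ())
splittings-irredundant (suc (suc s)) (suc i) zero    (inj₂ ())
splittings-irredundant (suc (suc s)) (suc i) (suc j) r =
  cong suc (splittings-irredundant s i j (Sum.map unshift unshift r))
  where
  unshift : ∀ {x y : ℕ × ℕ} → map suc suc x ≡ map suc suc y → x ≡ y
  unshift = cong (map pred pred)

splittings-complete : ∀ p q → Covers (UpTo swap) (splittings (p + q)) (p , q)
splittings-complete zero    q    = zero , inj₁ refl
splittings-complete (suc p) zero rewrite +-identityʳ p = zero , inj₂ refl
splittings-complete (suc p) (suc q) rewrite +-suc p q =
  map suc (Sum.map (cong (map suc suc)) (cong (map suc suc))) (splittings-complete p q)

-- (c , p , q): the numbers of left vertices adjacent to both right vertices,
-- to the first only, and to the second only.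
Profile : Set
Profile = ℕ × ℕ × ℕ

size : Profile → ℕ
size (c , p , q) = c + (p + q)

Ordered : Profile → Set
Ordered (_ , p , q) = p ≤ q

flipProfile : Profile → Profile
flipProfile = map₂ swap

Covered : Fin 2 → Profile → Set
Covered zero       (c , p , q) = 0 < c + p
Covered (suc zero) (c , p , q) = 0 < c + q

Balanced : Profile → Set
Balanced t = Covered zero t ⇔ Covered (suc zero) t

-- Profiles of equivalent graphs: equal, or exchanged by swapping the right
-- vertices, which is allowed only when it leaves the connected co-domain fixed.
infix 4 _∼_
_∼_ : Profile → Profile → Set
t ∼ t′ = t ≡ t′ ⊎ (t ≡ flipProfile t′ × Balanced t)

#flipClasses : ℕ → ℕ
#flipClasses zero    = 1
#flipClasses (suc k) = suc ⌊ suc k /2⌋ + #flipClasses k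

flipReps : ∀ k → Fin (#flipClasses k) → Profile
flipReps zero    = (0 ,_) ∘ splittings 0
flipReps (suc k) = ((0 ,_) ∘ splittings (suc k)) ++ (map₁ suc ∘ flipReps k)

flipReps-size : ∀ k i → size (flipReps k i) ≡ k
flipReps-size zero    = splittings-sum 0
flipReps-size (suc k) = ++-all (λ t → size t ≡ suc k) (splittings-sum (suc k)) (cong suc ∘ flipReps-size k)

flipReps-ordered : ∀ k i → Ordered (flipReps k i)
flipReps-ordered zero    = splittings-ordered 0
flipReps-ordered (suc k) = ++-all Ordered (splittings-ordered (suc k)) (flipReps-ordered k)

flipReps-irredundant : ∀ k → Irredundant (UpTo flipProfile) (flipReps k)
flipReps-irredundant zero i j r = splittings-irredundant 0 i j (Sum.map (cong proj₂) (cong proj₂) r)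
flipReps-irredundant (suc k) = ++-irredundant (UpTo flipProfile)
  (λ i j r → splittings-irredundant (suc k) i j (Sum.map (cong proj₂) (cong proj₂) r))
  (λ i j r → flipReps-irredundant k i j (Sum.map unshift unshift r))
  (λ _ _ r → 0≢1+n (sameFirst r))
  (λ _ _ r → 1+n≢0 (sameFirst r))
  where
  unshift : ∀ {t t′ : Profile} → map₁ suc t ≡ map₁ suc t′ → t ≡ t′
  unshift = cong (map₁ pred)
  sameFirst : ∀ {t t′ : Profile} → UpTo flipProfile t t′ → proj₁ t ≡ proj₁ t′
  sameFirst = Sum.[ cong proj₁ , cong proj₁ ]

flipReps-splittings : ∀ s i → ∃[ j ] flipReps s j ≡ (0 , splittings s i)
flipReps-splittings zero    i = i , refl
flipReps-splittings (suc k) i = i ↑ˡ _ , lookup-++ˡ ((0 ,_) ∘ splittings (suc k)) (map₁ suc ∘ flipReps k) i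

flipReps-complete : ∀ c p q → Covers (UpTo flipProfile) (flipReps (c + (p + q))) (c , p , q)
flipReps-complete zero p q
  with i , r ← splittings-complete p q
  with j , eq ← flipReps-splittings (p + q) i
  = j , subst (UpTo flipProfile (0 , p , q)) (sym eq) (Sum.map (cong (0 ,_)) (cong (0 ,_)) r)
flipReps-complete (suc c) p q = ++-coversʳ (UpTo flipProfile) _ _
  (map₂ (Sum.map (cong (map₁ suc)) (cong (map₁ suc))) (flipReps-complete c p q))

#profileClasses : ℕ → ℕ
#profileClasses zero    = #flipClasses zero
#profileClasses (suc k) = suc (#flipClasses (suc k))

-- A flip class splits into two ∼-classes exactly when it is one-sided, i.e.
-- {(0 , k , 0) , (0 , 0 , k)} with k > 0; flipReps contains (0 , 0 , k).
profileReps : ∀ k → Fin (#profileClasses k) → Profile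
profileReps zero    = flipReps zero
profileReps (suc k) = (0 , suc k , 0) ∷ flipReps (suc k)

profileReps-size : ∀ k i → size (profileReps k i) ≡ k
profileReps-size zero    i       = flipReps-size zero i
profileReps-size (suc k) zero    = cong suc (+-identityʳ k)
profileReps-size (suc k) (suc i) = flipReps-size (suc k) i

flipReps⊆profileReps : ∀ k j → ∃[ i ] profileReps k i ≡ flipReps k j
flipReps⊆profileReps zero    j = j , refl
flipReps⊆profileReps (suc k) j = suc j , refl

∼⇒UpTo : ∀ {t t′} → t ∼ t′ → UpTo flipProfile t t′
∼⇒UpTo = Sum.map₂ proj₁

oneSided-unordered : ∀ k → ¬ Ordered (0 , suc k , 0)
oneSided-unordered k ()

oneSided-unbalanced : ∀ k → ¬ Balanced (0 , suc k , 0)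
oneSided-unbalanced k bal = n≮n 0 (Equivalence.to bal (s≤s z≤n))

profileReps-irredundant : ∀ k → Irredundant _∼_ (profileReps k)
profileReps-irredundant zero i j r = flipReps-irredundant zero i j (∼⇒UpTo r)
profileReps-irredundant (suc k) zero    zero    _ = refl
profileReps-irredundant (suc k) zero    (suc j) (inj₁ eq) =
  ⊥-elim (oneSided-unordered k (subst Ordered (sym eq) (flipReps-ordered (suc k) j)))
profileReps-irredundant (suc k) zero    (suc j) (inj₂ (_ , bal)) = ⊥-elim (oneSided-unbalanced k bal)
profileReps-irredundant (suc k) (suc i) zero    (inj₁ eq) =
  ⊥-elim (oneSided-unordered k (subst Ordered eq (flipReps-ordered (suc k) i)))
profileReps-irredundant (suc k) (suc i) zero    (inj₂ (eq , bal)) =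
  ⊥-elim (oneSided-unbalanced k (⇔.sym (subst Balanced eq bal)))
profileReps-irredundant (suc k) (suc i) (suc j) r =
  cong suc (flipReps-irredundant (suc k) i j (∼⇒UpTo r))

profileReps-complete-viaFlip : ∀ c p q → (q ≤ p → Balanced (c , p , q)) →
  Covers _∼_ (profileReps (c + (p + q))) (c , p , q)
profileReps-complete-viaFlip c p q balanced
  with j , r ← flipReps-complete c p q
  with i , eq ← flipReps⊆profileReps (c + (p + q)) j
  = i , subst ((c , p , q) ∼_) (sym eq) (upgrade r)
  where
  k : ℕ
  k = c + (p + q)
  upgrade : UpTo flipProfile (c , p , q) (flipReps k j) → (c , p , q) ∼ flipReps k j
  upgrade (inj₁ eq′) = inj₁ eq′
  upgrade (inj₂ eq′) = inj₂ (eq′ , balanced (subst (Ordered ∘ flipProfile) (sym eq′) (flipReps-ordered k j)))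

profileReps-complete : ∀ c p q → Covers _∼_ (profileReps (c + (p + q))) (c , p , q)
profileReps-complete zero    (suc p) zero rewrite +-identityʳ p = zero , inj₁ refl
profileReps-complete zero    zero    q       =
  profileReps-complete-viaFlip zero zero q λ { z≤n → mk⇔ id id }
profileReps-complete zero    (suc p) (suc q) =
  profileReps-complete-viaFlip zero (suc p) (suc q) λ _ → mk⇔ (λ _ → s≤s z≤n) (λ _ → s≤s z≤n)
profileReps-complete (suc c) p q =
  profileReps-complete-viaFlip (suc c) p q λ _ → mk⇔ (λ _ → s≤s z≤n) (λ _ → s≤s z≤n)

Support : ℕ → Set
Support n = Fin n → Bool

ones : ∀ {n} → Support n → ℕ
ones S = Counting.count _≟ᵇ_ S true

ClassData : ℕ → Set
ClassData n = Support n × Profile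

infix 4 _≅_
_≅_ : ∀ {n} → ClassData n → ClassData n → Set
(S , t) ≅ (S′ , t′) = (∀ x → S x ≡ S′ x) × t ∼ t′

-- classReps n j lists the data (S , t) with size t ≡ ones S + j; the offset j
-- counts the supported left vertices already placed.
#classes : ℕ → ℕ → ℕ
#classes zero    j = #profileClasses j
#classes (suc n) j = #classes n j + #classes n (suc j)

classReps : ∀ n j → Fin (#classes n j) → ClassData n
classReps zero    j i = (λ ()) , profileReps j i
classReps (suc n) j   = (map₁ (false ∷_) ∘ classReps n j) ++ (map₁ (true ∷_) ∘ classReps n (suc j))

classReps-size : ∀ n j i → size (proj₂ (classReps n j i)) ≡ ones (proj₁ (classReps n j i)) + j
classReps-size zero    j = profileReps-size j
classReps-size (suc n) j = ++-all (λ d → size (proj₂ d) ≡ ones (proj₁ d) + j)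
  (classReps-size n j) (λ i → trans (classReps-size n (suc j) i) (+-suc _ j))

classReps-irredundant : ∀ n j → Irredundant _≅_ (classReps n j)
classReps-irredundant zero    j i i′ r = profileReps-irredundant j i i′ (proj₂ r)
classReps-irredundant (suc n) j = ++-irredundant _≅_
  (λ i i′ r → classReps-irredundant n j i i′ (map₁ (_∘ suc) r))
  (λ i i′ r → classReps-irredundant n (suc j) i i′ (map₁ (_∘ suc) r))
  (λ _ _ r → case proj₁ r zero of λ ())
  (λ _ _ r → case proj₁ r zero of λ ())

∷-≗ : ∀ {n} {S : Support (suc n)} {b S′} → S zero ≡ b → (∀ x → S (suc x) ≡ S′ x) →
  ∀ x → S x ≡ (b ∷ S′) x
∷-≗ S₀ _ zero    = S₀
∷-≗ _  s (suc x) = s x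

classReps-complete : ∀ n j (d : ClassData n) → size (proj₂ d) ≡ ones (proj₁ d) + j →
  Covers _≅_ (classReps n j) d
classReps-complete zero j (S , c , p , q) eq =
  map₂ ((λ ()) ,_) (subst (λ k → Covers _∼_ (profileReps k) (c , p , q)) eq (profileReps-complete c p q))
classReps-complete (suc n) j (S , t) eq with S zero in S₀
... | false = ++-coversˡ _≅_ _ _
  (map₂ (map₁ (∷-≗ S₀)) (classReps-complete n j (S ∘ suc , t) eq))
... | true  = ++-coversʳ _≅_ _ _
  (map₂ (map₁ (∷-≗ S₀)) (classReps-complete n (suc j) (S ∘ suc , t) (trans eq (sym (+-suc _ j)))))

-- Closed form of the class count

#flipClasses-consecutive : ∀ j → 2 * (#flipClasses j + #flipClasses (suc j)) ≡ (j + 2) * (j + 3)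
#flipClasses-consecutive zero    = refl
#flipClasses-consecutive (suc j) = begin
  2 * (#flipClasses (suc j) + #flipClasses (suc (suc j)))
    ≡⟨ regroup ⌊ suc j /2⌋ ⌊ suc (suc j) /2⌋ (#flipClasses j) ⟩
  2 * (#flipClasses j + #flipClasses (suc j)) + 2 * (⌊ suc j /2⌋ + ⌈ suc j /2⌉ + 2)
    ≡⟨ cong (λ s → 2 * (#flipClasses j + #flipClasses (suc j)) + 2 * (s + 2)) (⌊n/2⌋+⌈n/2⌉≡n (suc j)) ⟩
  2 * (#flipClasses j + #flipClasses (suc j)) + 2 * (suc j + 2)
    ≡⟨ cong (_+ 2 * (suc j + 2)) (#flipClasses-consecutive j) ⟩
  (j + 2) * (j + 3) + 2 * (suc j + 2)
    ≡⟨ expand j ⟩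
  (suc j + 2) * (suc j + 3) ∎
  where
  open ≡-Reasoning
  regroup : ∀ h₁ h₂ B → 2 * ((suc h₁ + B) + (suc h₂ + (suc h₁ + B))) ≡ 2 * (B + (suc h₁ + B)) + 2 * (h₁ + h₂ + 2)
  regroup = solve-∀
  expand : ∀ j → (j + 2) * (j + 3) + 2 * (suc j + 2) ≡ (suc j + 2) * (suc j + 3)
  expand = solve-∀

δ₀ : ℕ → ℕ
δ₀ zero    = 1
δ₀ (suc _) = 0

#profileClasses+δ₀ : ∀ j → #profileClasses j + δ₀ j ≡ suc (#flipClasses j)
#profileClasses+δ₀ zero    = refl
#profileClasses+δ₀ (suc j) = +-identityʳ _

-- The solution of Pascal's rule X n j + X n (j + 1) ≡ 2 * X (n + 1) j whose value at n = 1
-- is fixed by #flipClasses-consecutive.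
classPolynomial : ℕ → ℕ → ℕ
classPolynomial n j = 4 * (j + 2) * (j + 2) + 4 * (j + 2) * n + n * (n + 1) + 14

#classes-closedForm : ∀ m j → 16 * #classes (suc m) j + 16 * δ₀ j ≡ 2 ^ suc m * classPolynomial (suc m) j
#classes-closedForm zero j = begin
  16 * (#profileClasses j + #profileClasses (suc j)) + 16 * δ₀ j
    ≡⟨ regroup (#profileClasses j) (#flipClasses (suc j)) (δ₀ j) ⟩
  16 * ((#profileClasses j + δ₀ j) + suc (#flipClasses (suc j)))
    ≡⟨ cong (λ a → 16 * (a + suc (#flipClasses (suc j)))) (#profileClasses+δ₀ j) ⟩
  16 * (suc (#flipClasses j) + suc (#flipClasses (suc j)))
    ≡⟨ regroup′ (#flipClasses j) (#flipClasses (suc j)) ⟩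
  8 * (2 * (#flipClasses j + #flipClasses (suc j))) + 32
    ≡⟨ cong (λ a → 8 * a + 32) (#flipClasses-consecutive j) ⟩
  8 * ((j + 2) * (j + 3)) + 32
    ≡⟨ expand j ⟩
  2 * classPolynomial 1 j ∎
  where
  open ≡-Reasoning
  regroup : ∀ A B d → 16 * (A + suc B) + 16 * d ≡ 16 * ((A + d) + suc B)
  regroup = solve-∀
  regroup′ : ∀ A B → 16 * (suc A + suc B) ≡ 8 * (2 * (A + B)) + 32
  regroup′ = solve-∀
  expand : ∀ j → 8 * ((j + 2) * (j + 3)) + 32 ≡ 2 * (4 * (j + 2) * (j + 2) + 4 * (j + 2) * 1 + 1 * (1 + 1) + 14)
  expand = solve-∀
#classes-closedForm (suc m) j = begin
  16 * (#classes (suc m) j + #classes (suc m) (suc j)) + 16 * δ₀ j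
    ≡⟨ regroup (#classes (suc m) j) (#classes (suc m) (suc j)) (δ₀ j) ⟩
  (16 * #classes (suc m) j + 16 * δ₀ j) + (16 * #classes (suc m) (suc j) + 16 * δ₀ (suc j))
    ≡⟨ cong₂ _+_ (#classes-closedForm m j) (#classes-closedForm m (suc j)) ⟩
  2 ^ suc m * classPolynomial (suc m) j + 2 ^ suc m * classPolynomial (suc m) (suc j)
    ≡⟨ pascal (2 ^ suc m) m j ⟩
  2 ^ suc (suc m) * classPolynomial (suc (suc m)) j ∎
  where
  open ≡-Reasoning
  regroup : ∀ A B d → 16 * (A + B) + 16 * d ≡ (16 * A + 16 * d) + (16 * B + 0)
  regroup = solve-∀
  pascal : ∀ P m j →
    P * (4 * (j + 2) * (j + 2) + 4 * (j + 2) * suc m + suc m * (suc m + 1) + 14)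
      + P * (4 * (suc j + 2) * (suc j + 2) + 4 * (suc j + 2) * suc m + suc m * (suc m + 1) + 14)
    ≡ 2 * P * (4 * (j + 2) * (j + 2) + 4 * (j + 2) * suc (suc m) + suc (suc m) * (suc (suc m) + 1) + 14)
  pascal = solve-∀

#classes-formula : ∀ n → n ≥ 1 →
  16 * #classes n 0 + 16 ≡ 30 * 2 ^ n + 8 * n * 2 ^ n + n * (n + 1) * 2 ^ n
#classes-formula (suc m) _ = trans (#classes-closedForm m 0) (expand (2 ^ suc m) (suc m))
  where
  expand : ∀ P n → P * (4 * (0 + 2) * (0 + 2) + 4 * (0 + 2) * n + n * (n + 1) + 14)
                  ≡ 30 * P + 8 * n * P + n * (n + 1) * P
  expand = solve-∀

-- Set-labeled equivalence of (n,2)-bipartite graphs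

module _ {n r : ℕ} where

  setLabeledEquiv-sym : {G H : BipGraph n r} → SetLabeledEquiv G H → SetLabeledEquiv H G
  setLabeledEquiv-sym {G} {H} (α , β , edges , ic , oc) = Perm.flip α , Perm.flip β ,
    (λ x y → ⇔.sym (subst₂ (λ u v → G (α ⟨$⟩ˡ x) (β ⟨$⟩ˡ y) ≡ true ⇔ H u v ≡ true)
                       (inverseʳ α) (inverseʳ β) (edges (α ⟨$⟩ˡ x) (β ⟨$⟩ˡ y))))
    , ⇔.sym ∘ ic , ⇔.sym ∘ oc

  setLabeledEquiv-trans : {G H K : BipGraph n r} → SetLabeledEquiv G H → SetLabeledEquiv H K → SetLabeledEquiv G K
  setLabeledEquiv-trans (α , β , edges , ic , oc) (α′ , β′ , edges′ , ic′ , oc′) =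
    α Perm.∘ₚ α′ , β Perm.∘ₚ β′ ,
    (λ x y → ⇔.trans (edges x y) (edges′ _ _)) ,
    (λ x → ⇔.trans (ic x) (ic′ x)) , (λ y → ⇔.trans (oc y) (oc′ y))

numClasses-fromRepresentatives : ∀ {n r N} (rep : Fin N → BipGraph n r) →
  (∀ G → ∃[ i ] SetLabeledEquiv G (rep i)) →
  (∀ i j → SetLabeledEquiv (rep i) (rep j) → i ≡ j) →
  NumClasses n r N
numClasses-fromRepresentatives {n} {r} {N} rep find rep-injective = classOf , onto , fibres
  where
  classOf : BipGraph n r → Fin N
  classOf = proj₁ ∘ find
  onto : ∀ i → ∃[ G ] classOf G ≡ i
  onto i = rep i , sym (rep-injective i (classOf (rep i)) (proj₂ (find (rep i))))
  fibres : ∀ G₁ G₂ → (classOf G₁ ≡ classOf G₂) ⇔ SetLabeledEquiv G₁ G₂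
  fibres G₁ G₂ = mk⇔
    (λ same → setLabeledEquiv-trans (subst (SetLabeledEquiv G₁ ∘ rep) same (proj₂ (find G₁)))
                                    (setLabeledEquiv-sym (proj₂ (find G₂))))
    (λ G₁~G₂ → rep-injective _ _ (setLabeledEquiv-trans (setLabeledEquiv-sym (proj₂ (find G₁)))
                                   (setLabeledEquiv-trans G₁~G₂ (proj₂ (find G₂)))))

≡-true-⇔ : ∀ {a b : Bool} → a ≡ b → (a ≡ true ⇔ b ≡ true)
≡-true-⇔ refl = ⇔.refl

⇔-true-≡ : ∀ {a b : Bool} → (a ≡ true ⇔ b ≡ true) → a ≡ b
⇔-true-≡ {false} {false} _ = refl
⇔-true-≡ {false} {true}  a⇔b = Equivalence.from a⇔b refl
⇔-true-≡ {true}  {false} a⇔b = sym (Equivalence.to a⇔b refl)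
⇔-true-≡ {true}  {true}  _ = refl

Row : Set
Row = Bool × Bool

_≟ʳ_ : DecidableEquality Row
_≟ʳ_ = ≡-dec _≟ᵇ_ _≟ᵇ_

open Counting _≟ʳ_

entry : Fin 2 → Row → Bool
entry zero       = proj₁
entry (suc zero) = proj₂

row : ∀ {n} → BipGraph n 2 → Fin n → Row
row G x = G x zero , G x (suc zero)

row-entry : ∀ {n} (G : BipGraph n 2) x y → entry y (row G x) ≡ G x y
row-entry G x zero       = refl
row-entry G x (suc zero) = refl

fromRows : ∀ {n} → (Fin n → Row) → BipGraph n 2
fromRows r x y = entry y (r x)

nonzero : Row → Bool
nonzero (a , b) = a ∨ b

profile : ∀ {n} → (Fin n → Row) → Profile
profile g = count g (true , true) , count g (true , false) , count g (false , true)

profile-cong : ∀ {n} {g h : Fin n → Row} → (∀ x → g x ≡ h x) → profile g ≡ profile h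
profile-cong g≗h = cong₂ _,_ (count-cong g≗h _) (cong₂ _,_ (count-cong g≗h _) (count-cong g≗h _))

profile-permute : ∀ {n} (g : Fin n → Row) (α : Permutation′ n) → profile g ≡ profile (g ∘ (α ⟨$⟩ʳ_))
profile-permute g α = cong₂ _,_ (count-permute g α _) (cong₂ _,_ (count-permute g α _) (count-permute g α _))

profile-swap : ∀ {n} (g : Fin n → Row) → profile (swap ∘ g) ≡ flipProfile (profile g)
profile-swap g = cong₂ _,_ (flipCount _) (cong₂ _,_ (flipCount _) (flipCount _))
  where
  flipCount : ∀ b → count (swap ∘ g) b ≡ count g (swap b)
  flipCount = count-involution swap (λ _ → refl) g

+-interchange₄ : ∀ z c p q Z C P Q →
  (z + Z) + ((c + C) + ((p + P) + (q + Q))) ≡ (z + (c + (p + q))) + (Z + (C + (P + Q)))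
+-interchange₄ = solve-∀

size-profile+zeroRows : ∀ {n} (g : Fin n → Row) → count g (false , false) + size (profile g) ≡ n
size-profile+zeroRows {zero}  g = refl
size-profile+zeroRows {suc n} g = trans
  (+-interchange₄ (i₀ (false , false)) (i₀ (true , true)) (i₀ (true , false)) (i₀ (false , true))
            (rest (false , false)) (rest (true , true)) (rest (true , false)) (rest (false , true)))
  (cong₂ _+_ (oneRow (g zero)) (size-profile+zeroRows (g ∘ suc)))
  where
  i₀ rest : Row → ℕ
  i₀ = indicator (g zero)
  rest = count (g ∘ suc)
  oneRow : ∀ r → indicator r (false , false) + size (indicator r (true , true) , indicator r (true , false) , indicator r (false , true)) ≡ 1
  oneRow (false , false) = refl
  oneRow (false , true)  = refl
  oneRow (true  , false) = refl
  oneRow (true  , true)  = refl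

profile-counts : ∀ {n} (g h : Fin n → Row) → profile g ≡ profile h → ∀ b → count g b ≡ count h b
profile-counts {n} g h eq (true  , true)  = cong proj₁ eq
profile-counts {n} g h eq (true  , false) = cong (proj₁ ∘ proj₂) eq
profile-counts {n} g h eq (false , true)  = cong (proj₂ ∘ proj₂) eq
profile-counts {n} g h eq (false , false) = +-cancelʳ-≡ _ _ _ (begin
  count g (false , false) + size (profile g) ≡⟨ size-profile+zeroRows g ⟩
  n                                          ≡⟨ size-profile+zeroRows h ⟨
  count h (false , false) + size (profile h) ≡⟨ cong (λ t → count h (false , false) + size t) eq ⟨
  count h (false , false) + size (profile g) ∎)
  where open ≡-Reasoning

ones-nonzero : ∀ {n} (g : Fin n → Row) → ones (nonzero ∘ g) ≡ size (profile g)
ones-nonzero {zero}  g = refl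
ones-nonzero {suc n} g = trans
  (cong₂ _+_ (oneRow (g zero)) (ones-nonzero (g ∘ suc)))
  (sym (+-interchange₄ 0 (i₀ (true , true)) (i₀ (true , false)) (i₀ (false , true))
                 0 (rest (true , true)) (rest (true , false)) (rest (false , true))))
  where
  i₀ rest : Row → ℕ
  i₀ = indicator (g zero)
  rest = count (g ∘ suc)
  oneRow : ∀ r → Counting.indicator _≟ᵇ_ (nonzero r) true
               ≡ size (indicator r (true , true) , indicator r (true , false) , indicator r (false , true))
  oneRow (false , false) = refl
  oneRow (false , true)  = refl
  oneRow (true  , false) = refl
  oneRow (true  , true)  = refl

inIc⇔nonzero : ∀ {n} (G : BipGraph n 2) x → InIc G x ⇔ nonzero (row G x) ≡ true
inIc⇔nonzero G x = mk⇔ to from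
  where
  to : InIc G x → nonzero (row G x) ≡ true
  to (zero     , e) rewrite e = refl
  to (suc zero , e) rewrite e = ∨-zeroʳ (G x zero)
  from : nonzero (row G x) ≡ true → InIc G x
  from e with G x zero in e₀
  ... | true  = zero , e₀
  ... | false = suc zero , e

onlyEdgeTo : Fin 2 → Row
onlyEdgeTo zero       = true , false
onlyEdgeTo (suc zero) = false , true

entry-true⇔ : ∀ y r → entry y r ≡ true ⇔ (r ≡ (true , true) ⊎ r ≡ onlyEdgeTo y)
entry-true⇔ zero       (true  , true)  = mk⇔ (λ _ → inj₁ refl) (λ _ → refl)
entry-true⇔ zero       (true  , false) = mk⇔ (λ _ → inj₂ refl) (λ _ → refl)
entry-true⇔ zero       (false , b)     = mk⇔ (λ ()) λ { (inj₁ ()) ; (inj₂ ()) }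
entry-true⇔ (suc zero) (true  , true)  = mk⇔ (λ _ → inj₁ refl) (λ _ → refl)
entry-true⇔ (suc zero) (false , true)  = mk⇔ (λ _ → inj₂ refl) (λ _ → refl)
entry-true⇔ (suc zero) (a     , false) = mk⇔ (λ ()) λ { (inj₁ ()) ; (inj₂ ()) }

inOc⇔covered : ∀ {n} (G : BipGraph n 2) y → InOc G y ⇔ Covered y (profile (row G))
inOc⇔covered G zero = ⇔.sym (⇔.trans (count-pos-+⇔ (row G) (true , true) (true , false))
  (⇔.sym (Σ.congˡ {k = equivalence} (entry-true⇔ zero _))))
inOc⇔covered G (suc zero) = ⇔.sym (⇔.trans (count-pos-+⇔ (row G) (true , true) (false , true))
  (⇔.sym (Σ.congˡ {k = equivalence} (entry-true⇔ (suc zero) _))))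

swap₂ : Permutation′ 2
swap₂ = Perm.swap Perm.id

⟨$⟩ʳ-injective : ∀ {n} (π : Permutation′ n) {i j} → π ⟨$⟩ʳ i ≡ π ⟨$⟩ʳ j → i ≡ j
⟨$⟩ʳ-injective π e = trans (sym (inverseˡ π)) (trans (cong (π ⟨$⟩ˡ_) e) (inverseˡ π))

permutation₂ : (β : Permutation′ 2) → (∀ y → β ⟨$⟩ʳ y ≡ y) ⊎ (∀ y → β ⟨$⟩ʳ y ≡ swap₂ ⟨$⟩ʳ y)
permutation₂ β with β ⟨$⟩ʳ zero in e₀ | β ⟨$⟩ʳ suc zero in e₁
... | zero     | suc zero = inj₁ λ { zero → e₀ ; (suc zero) → e₁ }
... | suc zero | zero     = inj₂ λ { zero → e₀ ; (suc zero) → e₁ }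
... | zero     | zero     = case ⟨$⟩ʳ-injective β (trans e₀ (sym e₁)) of λ ()
... | suc zero | suc zero = case ⟨$⟩ʳ-injective β (trans e₀ (sym e₁)) of λ ()

∼⇒covered⇔ : ∀ {t t′} → t ∼ t′ → ∀ y → Covered y t ⇔ Covered y t′
∼⇒covered⇔ (inj₁ refl)         _          = ⇔.refl
∼⇒covered⇔ (inj₂ (refl , bal)) zero       = bal
∼⇒covered⇔ (inj₂ (refl , bal)) (suc zero) = ⇔.sym bal

flip-balanced : ∀ {t t′} → t ≡ flipProfile t′ → (∀ y → Covered y t ⇔ Covered y t′) → Balanced t
flip-balanced refl covered = covered zero

invariant : ∀ {n} → BipGraph n 2 → ClassData n
invariant G = nonzero ∘ row G , profile (row G)

module _ {n : ℕ} {G H : BipGraph n 2} where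

  setLabeledEquiv⇒≅ : SetLabeledEquiv G H → invariant G ≅ invariant H
  setLabeledEquiv⇒≅ (α , β , edges , ic , oc) = support , profiles (permutation₂ β)
    where
    open ≡-Reasoning
    H∘α : Fin n → Row
    H∘α = row H ∘ (α ⟨$⟩ʳ_)
    rowVia : ∀ {f : Fin 2 → Fin 2} → (∀ y → β ⟨$⟩ʳ y ≡ f y) →
      ∀ x → row G x ≡ (H (α ⟨$⟩ʳ x) (f zero) , H (α ⟨$⟩ʳ x) (f (suc zero)))
    rowVia β≗f x = cong₂ _,_ (edge zero) (edge (suc zero))
      where
      edge : ∀ y → G x y ≡ H (α ⟨$⟩ʳ x) _
      edge y = trans (⇔-true-≡ (edges x y)) (cong (H _) (β≗f y))
    support : ∀ x → nonzero (row G x) ≡ nonzero (row H x)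
    support x = ⇔-true-≡ (⇔.trans (⇔.sym (inIc⇔nonzero G x)) (⇔.trans (ic x) (inIc⇔nonzero H x)))
    covered : ∀ y → Covered y (profile (row G)) ⇔ Covered y (profile (row H))
    covered y = ⇔.trans (⇔.sym (inOc⇔covered G y)) (⇔.trans (oc y) (inOc⇔covered H y))
    profiles : (∀ y → β ⟨$⟩ʳ y ≡ y) ⊎ (∀ y → β ⟨$⟩ʳ y ≡ swap₂ ⟨$⟩ʳ y) → profile (row G) ∼ profile (row H)
    profiles (inj₁ β≗id) = inj₁ (begin
      profile (row G) ≡⟨ profile-cong (rowVia β≗id) ⟩
      profile H∘α     ≡⟨ profile-permute (row H) α ⟨
      profile (row H) ∎)
    profiles (inj₂ β≗swap) = inj₂ (flipped , flip-balanced flipped covered)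
      where
      flipped : profile (row G) ≡ flipProfile (profile (row H))
      flipped = begin
        profile (row G)               ≡⟨ profile-cong (rowVia β≗swap) ⟩
        profile (swap ∘ H∘α)          ≡⟨ profile-permute (swap ∘ row H) α ⟨
        profile (swap ∘ row H)        ≡⟨ profile-swap (row H) ⟩
        flipProfile (profile (row H)) ∎

  sameSupport⇒inIc⇔ : (∀ x → nonzero (row G x) ≡ nonzero (row H x)) → ∀ x → InIc G x ⇔ InIc H x
  sameSupport⇒inIc⇔ support x = ⇔.trans (inIc⇔nonzero G x)
    (subst (λ b → b ≡ true ⇔ InIc H x) (sym (support x)) (⇔.sym (inIc⇔nonzero H x)))

  ∼⇒inOc⇔ : profile (row G) ∼ profile (row H) → ∀ y → InOc G y ⇔ InOc H y
  ∼⇒inOc⇔ profiles y =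
    ⇔.trans (inOc⇔covered G y) (⇔.trans (∼⇒covered⇔ profiles y) (⇔.sym (inOc⇔covered H y)))

  ≅⇒setLabeledEquiv : invariant G ≅ invariant H → SetLabeledEquiv G H
  ≅⇒setLabeledEquiv (support , inj₁ eq)
    with α , rows ← count⇒permutation (row G) (row H) (profile-counts (row G) (row H) eq)
    = α , Perm.id , (λ x y → ≡-true-⇔ (edge x y)) , sameSupport⇒inIc⇔ support , ∼⇒inOc⇔ (inj₁ eq)
    where
    edge : ∀ x y → G x y ≡ H (α ⟨$⟩ʳ x) y
    edge x y = trans (sym (row-entry G x y)) (trans (cong (entry y) (rows x)) (row-entry H _ y))
  ≅⇒setLabeledEquiv (support , inj₂ (eq , bal))
    with α , rows ← count⇒permutation (row G) (swap ∘ row H)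
                      (profile-counts (row G) (swap ∘ row H) (trans eq (sym (profile-swap (row H)))))
    = α , swap₂ , (λ x y → ≡-true-⇔ (edge x y)) , sameSupport⇒inIc⇔ support , ∼⇒inOc⇔ (inj₂ (eq , bal))
    where
    edge : ∀ x y → G x y ≡ H (α ⟨$⟩ʳ x) (swap₂ ⟨$⟩ʳ y)
    edge x zero       = cong proj₁ (rows x)
    edge x (suc zero) = cong proj₂ (rows x)

next : Profile → Row × Profile
next (suc c , p     , q) = (true  , true)  , (c , p , q)
next (zero  , suc p , q) = (true  , false) , (zero , p , q)
next (zero  , zero  , q) = (false , true)  , (zero , zero , pred q)

fill : ∀ {n} → Support n → Profile → Fin n → Row
fill {zero}  S t = λ ()
fill {suc n} S t = if S zero then proj₁ (next t) ∷ fill (S ∘ suc) (proj₂ (next t))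
                             else (false , false) ∷ fill (S ∘ suc) t

next-nonzero : ∀ t → nonzero (proj₁ (next t)) ≡ true
next-nonzero (suc c , p     , q) = refl
next-nonzero (zero  , suc p , q) = refl
next-nonzero (zero  , zero  , q) = refl

fill-support : ∀ {n} (S : Support n) t x → nonzero (fill S t x) ≡ S x
fill-support {suc n} S t x with S zero in S₀ | x
... | false | zero  = sym S₀
... | true  | zero  = trans (next-nonzero t) (sym S₀)
... | false | suc x = fill-support (S ∘ suc) t x
... | true  | suc x = fill-support (S ∘ suc) (proj₂ (next t)) x

fill-profile : ∀ {n} (S : Support n) t → size t ≡ ones S → profile (fill S t) ≡ t
fill-profile {zero}  S (zero  , zero  , zero)  _ = refl
fill-profile {suc n} S t eq with S zero
... | false = fill-profile (S ∘ suc) t eq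
fill-profile {suc n} S (suc c , p     , q) eq | true =
  cong (map₁ suc) (fill-profile (S ∘ suc) (c , p , q) (suc-injective eq))
fill-profile {suc n} S (zero  , suc p , q) eq | true =
  cong (map₂ (map₁ suc)) (fill-profile (S ∘ suc) (zero , p , q) (suc-injective eq))
fill-profile {suc n} S (zero  , zero  , suc q) eq | true =
  cong (map₂ (map₂ suc)) (fill-profile (S ∘ suc) (zero , zero , q) (suc-injective eq))

numClasses₂ : ∀ n → NumClasses n 2 (#classes n 0)
numClasses₂ n = numClasses-fromRepresentatives rep find rep-injective
  where
  S : Fin (#classes n 0) → Support n
  S = proj₁ ∘ classReps n 0
  t : Fin (#classes n 0) → Profile
  t = proj₂ ∘ classReps n 0
  rep : Fin (#classes n 0) → BipGraph n 2
  rep i = fromRows (fill (S i) (t i))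
  rep-support : ∀ i x → nonzero (row (rep i) x) ≡ S i x
  rep-support i = fill-support (S i) (t i)
  rep-profile : ∀ i → profile (row (rep i)) ≡ t i
  rep-profile i = fill-profile (S i) (t i) (trans (classReps-size n 0 i) (+-identityʳ _))
  find : ∀ G → ∃[ i ] SetLabeledEquiv G (rep i)
  find G with i , support , profiles ← classReps-complete n 0 (invariant G)
                                         (trans (sym (ones-nonzero (row G))) (sym (+-identityʳ _)))
    = i , ≅⇒setLabeledEquiv ((λ x → trans (support x) (sym (rep-support i x)))
                            , subst (_ ∼_) (sym (rep-profile i)) profiles)
  rep-injective : ∀ i j → SetLabeledEquiv (rep i) (rep j) → i ≡ j
  rep-injective i j i~j with support , profiles ← setLabeledEquiv⇒≅ i~j
    = classReps-irredundant n 0 i j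
        ( (λ x → trans (sym (rep-support i x)) (trans (support x) (rep-support j x)))
        , subst₂ _∼_ (rep-profile i) (rep-profile j) profiles)

mainTheorem5 : ∀ (n : ℕ) → n ≥ 1 →
    ∃[ N ] (NumClasses n 2 N
           × 16 * N + 16 ≡ 30 * 2 ^ n + 8 * n * 2 ^ n + n * (n + 1) * 2 ^ n)
mainTheorem5 n n≥1 = #classes n 0 , numClasses₂ n , #classes-formula n n≥1
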